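{- If a function $f\colon[0,1]\to\mathbb{R}$ is uniformly continuous, then $f$ is induced by a uniformly continuous code.
   Context: The setting is constructive. Reals: - Real numbers are regular sequences of rationals $\langle r_n\rangle$ with $|r_n-r_{n+1}|\le2^{ -(n+1)}$, with equality $\langle r_n\rangle\simeq\langle q_n\rangle$ iff $\forall n\,|r_{n+1}-q_{n+1}|\le2^{ -n}$. Functions $[0,1]\to\mathbb{R}$ respect $\simeq$. - $f$ is uniformly continuous if there is $\omega$ with $\forall k\,\forall x,y\in[0,1]\,(|x-y|\le2^{ -\omega(k)}\to|f(x)-f(y)|\le2^{ -k})$. Ternary tree: - For $s\in\{0,1,2\}^*$, define $N(\langle\rangle)=1$ and $N(s*\langle i\rangle)=2N(s)+(i-1)$. - For $\alpha\in\{0,1,2\}^{\mathbb{N}}$, $\Phi(\alpha)=\langle2^{ -(n+1)}N(\overline{\alpha}n)\rangle_n$. - For $s\in\{0,1,2\}^*$, $\mathbb{I}_s=(2^{ -(|s|+1)}(N(s)-1),\,2^{ -(|s|+1)}(N(s)+1))$. Rational intervals: - $\mathbb{T}=\{(p,q)\in\mathbb{Q}^2:p\le q\}$, identified with a subset of $\mathbb{N}$ via a fixed coding. - For $I=(p,q)$: $|I|=q-p$. - $(p,q)\sqsubseteq(p',q')$ iff $p'\le p$ and $q\le q'$. - $(p,q)\approx(p',q')$ iff $p'\le q$ and $p\le q'$. - $\dot-$ is truncated subtraction. Codes: - A code of a continuous function is $\varphi\colon\{0,1,2\}^*\to\mathbb{N}$ such that: (C1) $\varphi(s)\ne0\to\varphi(s)\dot-1\in\mathbb{T}$;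 (C2) $\forall k\,\forall\alpha\,\exists n\,(\varphi(\overline{\alpha}n)\ne0\wedge|\varphi(\overline{\alpha}n)\dot-1|\le2^{ -k})$; (C3) for all $s$ and $i\in\{0,1,2\}$, $\varphi(s)\ne0\to(\varphi(s*\langle i\rangle)\ne0\wedge\varphi(s*\langle i\rangle)\dot-1\sqsubseteq\varphi(s)\dot-1)$; (C4) for all $s,t$, $(\varphi(s)\ne0\wedge\varphi(t)\ne0\wedge\mathbb{I}_s\approx\mathbb{I}_t)\to\varphi(s)\dot-1\approx\varphi(t)\dot-1$. - A code is uniformly continuous if $\forall k\,\exists n\,\forall\alpha\in\{0,1,2\}^{\mathbb{N}}\,(\varphi(\overline{\alpha}n)\ne0\wedge|\varphi(\overline{\alpha}n)\dot-1|\le2^{ -k})$. - For a code $\varphi$, let $h_k(\alpha)$ be the least $n$ with $\varphi(\overline{\alpha}n)\ne0$ and $|\varphi(\overline{\alpha}n)\dot-1|\le2^{ -k}$. Let $f^\varphi_T(\alpha)=\langle\varphi(\overline{\alpha}h_n(\alpha))\dot-1\rangle_n$. This is a shrinking sequence of intervals $\langle\mathbb{J}_n\rangle$: $\mathbb{J}_{n+1}\sqsubseteq\mathbb{J}_n$ and $\forall k\,\exists n\,|\mathbb{J}_n|\le2^{ -k}$. - A shrinking sequence determines the real number $\langle\text{left endpoint of }\mathbb{J}_{\delta(n)}\rangle_n$, where $\delta(k)$ is the least $n$ with $|\mathbb{J}_n|\le2^{ -(k+1)}$. - $f$ is induced by $\varphi$ if for every $\alpha$, $f(\Phi(\alpha))$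 equals the real number determined by $f^\varphi_T(\alpha)$. -}

module Defs where

open import Data.Nat as ℕ using (ℕ; zero; suc)
open import Data.Integer as ℤ using (ℤ; +_)
open import Data.Rational using (ℚ; 0ℚ; 1ℚ; ½; _+_; _-_; _*_; _/_; ∣_∣; _≤_)
open import Data.Rational.Properties using (_≤?_)
open import Data.Fin using (Fin; toℕ)
open import Data.List using (List; []; _∷ʳ_; length)
open import Data.Maybe using (Maybe; just; nothing)
open import Data.Product using (Σ; Σ-syntax; ∃; ∃-syntax; _×_; _,_; proj₁; proj₂)
open import Relation.Nullary using (Dec; yes; no; ¬_)
open import Relation.Binary.PropositionalEquality using (_≡_; refl; trans; sym)

2^-[_] : ℕ → ℚ
2^-[ zero ]  = 1ℚ
2^-[ suc n ] = ½ * 2^-[ n ]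

Seq : Set
Seq = ℕ → ℚ

IsReal : Seq → Set
IsReal r = ∀ n → ∣ r n - r (suc n) ∣ ≤ 2^-[ suc n ]

_≃_ : Seq → Seq → Set
r ≃ q = ∀ n → ∣ r (suc n) - q (suc n) ∣ ≤ 2^-[ n ]

-- |x - y| ≤ c  for reals x, y and a rational c
-- (x - y is the regular sequence ⟨x_{n+1} - y_{n+1}⟩_n; |z| ≤ c iff ∀n |z_n| ≤ c + 2^{-n};
--  in particular x ≃ y is exactly DistLe x y 0)
DistLe : Seq → Seq → ℚ → Set
DistLe x y c = ∀ n → ∣ x (suc n) - y (suc n) ∣ ≤ c + 2^-[ n ]

In01 : Seq → Set
In01 x = ∀ n → (0ℚ - 2^-[ n ] ≤ x n) × (x n ≤ 1ℚ + 2^-[ n ])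

Real01 : Seq → Set
Real01 x = IsReal x × In01 x

IsFun01 : (Seq → Seq) → Set
IsFun01 f = (∀ x → Real01 x → IsReal (f x))
          × (∀ x y → Real01 x → Real01 y → x ≃ y → f x ≃ f y)

UniformlyContinuous : (Seq → Seq) → Set
UniformlyContinuous f =
  Σ[ ω ∈ (ℕ → ℕ) ] (∀ k x y → Real01 x → Real01 y →
     DistLe x y 2^-[ ω k ] → DistLe (f x) (f y) 2^-[ k ])

Three : Set
Three = Fin 3

Cantor3 : Set
Cantor3 = ℕ → Three

-- N(⟨⟩) = 1,  N(s * ⟨i⟩) = 2 N(s) + (i - 1)   (lists are built by snoc)
N : List Three → ℤ
N s = go (+ 1) s
  where
  open import Data.List using (foldl)
  go : ℤ → List Three → ℤ
  go a s = foldl (λ acc i → (+ 2) ℤ.* acc ℤ.+ ((+ toℕ i) ℤ.- (+ 1))) a s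

prefix : Cantor3 → ℕ → List Three
prefix α zero    = []
prefix α (suc n) = prefix α n ∷ʳ α n

Φ : Cantor3 → Seq
Φ α n = 2^-[ suc n ] * (N (prefix α n) / 1)

Interval : Set
Interval = ℚ × ℚ

left right len : Interval → ℚ
left  (p , q) = p
right (p , q) = q
len   (p , q) = q - p

InT : Interval → Set
InT (p , q) = p ≤ q

_⊑_ : Interval → Interval → Set
(p , q) ⊑ (p' , q') = (p' ≤ p) × (q ≤ q')

_≈_ : Interval → Interval → Set
(p , q) ≈ (p' , q') = (p' ≤ q) × (p ≤ q')

𝕀 : List Three → Interval
𝕀 s = 2^-[ suc (length s) ] * ((N s ℤ.- + 1) / 1)
    , 2^-[ suc (length s) ] * ((N s ℤ.+ + 1) / 1)

-- A code value in ℕ is either 0 ("undefined") or c+1 with c the code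
-- of an element of ℚ²; we represent this as Maybe (ℚ × ℚ): nothing ↔ 0,
-- just I ↔ (code of I)+1, so that "φ(s) ∸ 1" is I.

PreCode : Set
PreCode = List Three → Maybe Interval

Fine : PreCode → List Three → ℕ → Set
Fine φ s k = Σ[ I ∈ Interval ] (φ s ≡ just I × len I ≤ 2^-[ k ])

Fine? : (φ : PreCode) (s : List Three) (k : ℕ) → Dec (Fine φ s k)
Fine? φ s k with φ s in eq
... | nothing = no λ { (I , () , _) }
... | just I with len I ≤? 2^-[ k ]
...   | yes le = yes (I , refl , le)
...   | no nle = no λ { (J , refl , le) → nle le }

record IsCode (φ : PreCode) : Set where
  field
    C1 : ∀ s I → φ s ≡ just I → InT I
    C2 : ∀ k (α : Cantor3) → Σ[ n ∈ ℕ ] Fine φ (prefix α n) k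
    C3 : ∀ s (i : Three) I → φ s ≡ just I →
           Σ[ J ∈ Interval ] (φ (s ∷ʳ i) ≡ just J × J ⊑ I)
    C4 : ∀ s t I J → φ s ≡ just I → φ t ≡ just J → 𝕀 s ≈ 𝕀 t → I ≈ J

UniformlyContinuousCode : PreCode → Set
UniformlyContinuousCode φ = ∀ k → Σ[ n ∈ ℕ ] (∀ (α : Cantor3) → Fine φ (prefix α n) k)

-- Bounded minimisation: given a witness P m, the least n ≤ m with P n

private
  search : {P : ℕ → Set} → ((n : ℕ) → Dec (P n)) → (m : ℕ) → P m → (n fuel : ℕ) → Σ ℕ P
  search P? m pm n zero = m , pm
  search P? m pm n (suc f) with P? n
  ... | yes pn = n , pn
  ... | no _   = search P? m pm (suc n) f

least : {P : ℕ → Set} → ((n : ℕ) → Dec (P n)) → (m : ℕ) → P m → Σ ℕ P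
least P? m pm = search P? m pm 0 m

module _ (φ : PreCode) (c : IsCode φ) (α : Cantor3) where
  open IsCode c

  hdata : (k : ℕ) → Σ ℕ (λ n → Fine φ (prefix α n) k)
  hdata k = least (λ n → Fine? φ (prefix α n) k) (proj₁ (C2 k α)) (proj₂ (C2 k α))

  h : ℕ → ℕ
  h k = proj₁ (hdata k)

  𝕁 : ℕ → Interval
  𝕁 n = proj₁ (proj₂ (hdata n))

  𝕁-len : ∀ n → len (𝕁 n) ≤ 2^-[ n ]
  𝕁-len n = proj₂ (proj₂ (proj₂ (hdata n)))

  δ : ℕ → ℕ
  δ k = proj₁ (least (λ n → len (𝕁 n) ≤? 2^-[ suc k ]) (suc k) (𝕁-len (suc k)))

  realOfCode : Seq
  realOfCode n = left (𝕁 (δ n))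

InducedBy : (f : Seq → Seq) (φ : PreCode) → IsCode φ → Set
InducedBy f φ c = ∀ (α : Cantor3) → f (Φ α) ≃ realOfCode φ c α

-- Sample f at the centre of each dyadic interval 𝕀_u. Once |u| ≥ ω(j+2), uniform
-- continuity puts the (j+2)-th approximation of f(centre u) less than 2^-j away from
-- f(x) for every x ∈ 𝕀_u, so the rational ball of radius 2^-j around it encloses
-- f on 𝕀_u. The code φ(s) intersects all such balls attached to initial segments
-- of s: it shrinks along s; codes over touching intervals overlap because their
-- balls all contain the value of f at a common point; ball k+1 is available at
-- depth k+1+ω(k+3), which makes the code uniformly fine; and f(Φ α) lies in every
-- ball above α, so it is the real number the code determines.

module Submission where

open import Level using (0ℓ)
open import Data.Nat as ℕ using (ℕ; zero; suc; _≤′_; ≤′-reflexive; ≤′-step)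
import Data.Nat.Properties as ℕ
open import Data.Integer as ℤ using (+_)
import Data.Integer.Properties as ℤ
open import Data.Rational
  using (ℚ; 0ℚ; 1ℚ; ½; _+_; _-_; _*_; _/_; ∣_∣; _≤_; -_; _⊔_; _⊓_; toℚᵘ; fromℚᵘ; nonNegative)
open import Data.Rational.Properties
import Data.Rational.Unnormalised as ℚᵘ
import Data.Rational.Unnormalised.Properties as ℚᵘ
open import Data.Product using (Σ; Σ-syntax; ∃-syntax; ∃₂; _×_; _,_; proj₁; proj₂; swap)
open import Data.Sum using (inj₁; inj₂)
open import Data.Unit using (tt)
open import Data.Maybe using (Maybe; just; nothing)
open import Data.List using (List; []; _∷_; _∷ʳ_; _++_; [_]; length; reverse; map; filter; upTo)
open import Data.List.Membership.Propositional using (_∈_)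
open import Data.List.Membership.Propositional.Properties
  using (∈-++⁺ˡ; ∈-++⁺ʳ; ∈-++⁻; ∈-map⁺; ∈-map⁻; ∈-filter⁺; ∈-filter⁻; ∈-upTo⁺)
open import Data.List.Relation.Unary.Any using (here; there)
open import Data.List.Reverse using (Reverse; reverseView; []; _∶_∶ʳ_)
import Data.List.Properties as List
open import Data.Fin using (toℕ) renaming (zero to 0F; suc to sucF)
open import Function using (const)
open import Relation.Nullary.Decidable using (dec⇒maybe)
open import Relation.Binary.PropositionalEquality
  using (_≡_; refl; sym; trans; cong; cong₂; subst; subst₂; module ≡-Reasoning)
open import Tactic.RingSolver using (solve-∀)
open import Tactic.RingSolver.Core.AlmostCommutativeRing using (AlmostCommutativeRing; fromCommutativeRing)

open import Defs

ℚ-ring : AlmostCommutativeRing 0ℓ 0ℓ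
ℚ-ring = fromCommutativeRing +-*-commutativeRing (λ q → dec⇒maybe (0ℚ ≟ q))

p≤q⇒0≤q-p : ∀ {p q} → p ≤ q → 0ℚ ≤ q - p
p≤q⇒0≤q-p {p} {q} p≤q = subst (_≤ q - p) (+-inverseʳ p) (+-monoˡ-≤ (- p) p≤q)

0≤q-p⇒p≤q : ∀ {p q} → 0ℚ ≤ q - p → p ≤ q
0≤q-p⇒p≤q {p} {q} 0≤q-p = subst₂ _≤_ (+-identityˡ p) (eq p q) (+-monoˡ-≤ p 0≤q-p)
  where
  eq : ∀ p q → q - p + p ≡ q
  eq = solve-∀ ℚ-ring

-- Linear arithmetic: exhibit q - p as a sum of manifestly nonnegative terms.
≤-bySlack : ∀ {p q} e → 0ℚ ≤ e → e ≡ q - p → p ≤ q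
≤-bySlack e 0≤e refl = 0≤q-p⇒p≤q 0≤e

p-ε≤q⇒p≤q+ε : ∀ {p q ε} → p - ε ≤ q → p ≤ q + ε
p-ε≤q⇒p≤q+ε {p} {q} {ε} h = ≤-bySlack (q - (p - ε)) (p≤q⇒0≤q-p h) (eq p q ε)
  where
  eq : ∀ p q ε → q - (p - ε) ≡ q + ε - p
  eq = solve-∀ ℚ-ring

p≤q+ε⇒p-ε≤q : ∀ {p q ε} → p ≤ q + ε → p - ε ≤ q
p≤q+ε⇒p-ε≤q {p} {q} {ε} h = ≤-bySlack (q + ε - p) (p≤q⇒0≤q-p h) (eq p q ε)
  where
  eq : ∀ p q ε → q + ε - p ≡ q - (p - ε)
  eq = solve-∀ ℚ-ring

/1-homo-+ : ∀ a b → (a ℤ.+ b) / 1 ≡ a / 1 + b / 1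
/1-homo-+ a b = trans (fromℚᵘ-cong unnormalised) (fromℚᵘ-toℚᵘ (a / 1 + b / 1))
  where
  unnormalised : ℚᵘ.mkℚᵘ (a ℤ.+ b) 0 ℚᵘ.≃ toℚᵘ (a / 1 + b / 1)
  unnormalised = ℚᵘ.≃-trans
    (ℚᵘ.*≡* (cong (ℤ._* + 1) (cong₂ ℤ._+_ (sym (ℤ.*-identityʳ a)) (sym (ℤ.*-identityʳ b)))))
    (ℚᵘ.≃-sym (ℚᵘ.≃-trans (toℚᵘ-homo-+ (a / 1) (b / 1))
      (ℚᵘ.+-cong (toℚᵘ-fromℚᵘ (ℚᵘ.mkℚᵘ a 0)) (toℚᵘ-fromℚᵘ (ℚᵘ.mkℚᵘ b 0)))))

2^-suc+2^-suc : ∀ n → 2^-[ suc n ] + 2^-[ suc n ] ≡ 2^-[ n ]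
2^-suc+2^-suc n = eq 2^-[ n ]
  where
  eq : ∀ t → ½ * t + ½ * t ≡ t
  eq = solve-∀ ℚ-ring

2^-nonNeg : ∀ n → 0ℚ ≤ 2^-[ n ]
2^-nonNeg zero    = ≤ᵇ⇒≤ tt
2^-nonNeg (suc n) = subst (_≤ ½ * 2^-[ n ]) (*-zeroʳ ½) (*-monoˡ-≤-nonNeg ½ (2^-nonNeg n))

2^-suc≤ : ∀ n → 2^-[ suc n ] ≤ 2^-[ n ]
2^-suc≤ n = ≤-bySlack 2^-[ suc n ] (2^-nonNeg (suc n)) (eq 2^-[ n ])
  where
  eq : ∀ t → ½ * t ≡ t - ½ * t
  eq = solve-∀ ℚ-ring

2^-antitone′ : ∀ {m n} → m ≤′ n → 2^-[ n ] ≤ 2^-[ m ]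
2^-antitone′ (≤′-reflexive refl) = ≤-refl
2^-antitone′ (≤′-step {n} m≤′n) = ≤-trans (2^-suc≤ n) (2^-antitone′ m≤′n)

2^-antitone : ∀ {m n} → m ℕ.≤ n → 2^-[ n ] ≤ 2^-[ m ]
2^-antitone m≤n = 2^-antitone′ (ℕ.≤⇒≤′ m≤n)

record Near (ε p q : ℚ) : Set where
  constructor near
  field
    p≤q+ε : p ≤ q + ε
    q≤p+ε : q ≤ p + ε

Near-sym : ∀ {ε p q} → Near ε p q → Near ε q p
Near-sym (near p≤ q≤) = near q≤ p≤

Near-refl : ∀ {ε p} → 0ℚ ≤ ε → Near ε p p
Near-refl {ε} {p} 0≤ε = near p≤p+ε p≤p+ε
  where
  p≤p+ε : p ≤ p + ε
  p≤p+ε = subst (_≤ p + ε) (+-identityʳ p) (+-monoʳ-≤ p 0≤ε)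

Near-weaken : ∀ {ε δ p q} → ε ≤ δ → Near ε p q → Near δ p q
Near-weaken {p = p} {q} ε≤δ (near p≤ q≤) =
  near (≤-trans p≤ (+-monoʳ-≤ q ε≤δ)) (≤-trans q≤ (+-monoʳ-≤ p ε≤δ))

Near-trans : ∀ {ε δ p q r} → Near ε p q → Near δ q r → Near (ε + δ) p r
Near-trans {ε} {δ} {p} {q} {r} (near p≤ q≤) (near q≤′ r≤) = near
  (≤-bySlack (q + ε - p + (r + δ - q)) (+-mono-≤ (p≤q⇒0≤q-p p≤) (p≤q⇒0≤q-p q≤′)) (eq p q r ε δ))
  (≤-bySlack (q + δ - r + (p + ε - q)) (+-mono-≤ (p≤q⇒0≤q-p r≤) (p≤q⇒0≤q-p q≤)) (eq′ p q r ε δ))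
  where
  eq : ∀ p q r ε δ → q + ε - p + (r + δ - q) ≡ r + (ε + δ) - p
  eq = solve-∀ ℚ-ring
  eq′ : ∀ p q r ε δ → q + δ - r + (p + ε - q) ≡ p + (ε + δ) - r
  eq′ = solve-∀ ℚ-ring

∣-∣≤⇒Near : ∀ {ε p q} → ∣ p - q ∣ ≤ ε → Near ε p q
∣-∣≤⇒Near {ε} {p} {q} ∣p-q∣≤ε = near
  (≤-bySlack (ε - ∣ p - q ∣ + (∣ p - q ∣ - (p - q)))
    (+-mono-≤ (p≤q⇒0≤q-p ∣p-q∣≤ε) (p≤q⇒0≤q-p (x≤∣x∣ (p - q)))) (eq₁ p q ε ∣ p - q ∣))
  (≤-bySlack (ε - ∣ p - q ∣ + (∣ p - q ∣ - - (p - q)))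
    (+-mono-≤ (p≤q⇒0≤q-p ∣p-q∣≤ε) (p≤q⇒0≤q-p -x≤∣x∣)) (eq₂ p q ε ∣ p - q ∣))
  where
  x≤∣x∣ : ∀ x → x ≤ ∣ x ∣
  x≤∣x∣ x with ≤-total 0ℚ x
  ... | inj₁ 0≤x = ≤-reflexive (sym (0≤p⇒∣p∣≡p 0≤x))
  ... | inj₂ x≤0 = ≤-trans x≤0 (0≤∣p∣ x)
  -x≤∣x∣ : - (p - q) ≤ ∣ p - q ∣
  -x≤∣x∣ = subst (- (p - q) ≤_) (∣-p∣≡∣p∣ (p - q)) (x≤∣x∣ (- (p - q)))
  eq₁ : ∀ p q ε a → ε - a + (a - (p - q)) ≡ q + ε - p
  eq₁ = solve-∀ ℚ-ring
  eq₂ : ∀ p q ε a → ε - a + (a - - (p - q)) ≡ p + ε - q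
  eq₂ = solve-∀ ℚ-ring

Near⇒∣-∣≤ : ∀ {ε p q} → Near ε p q → ∣ p - q ∣ ≤ ε
Near⇒∣-∣≤ {ε} {p} {q} (near p≤ q≤) with ∣p∣≡p∨∣p∣≡-p (p - q)
... | inj₁ eq = subst (_≤ ε) (sym eq) (≤-bySlack (q + ε - p) (p≤q⇒0≤q-p p≤) (eq₁ p q ε))
  where
  eq₁ : ∀ p q ε → q + ε - p ≡ ε - (p - q)
  eq₁ = solve-∀ ℚ-ring
... | inj₂ eq = subst (_≤ ε) (sym eq) (≤-bySlack (p + ε - q) (p≤q⇒0≤q-p q≤) (eq₂ p q ε))
  where
  eq₂ : ∀ p q ε → p + ε - q ≡ ε - - (p - q)
  eq₂ = solve-∀ ℚ-ring

IsReal⇒Near′ : ∀ {r m n} → IsReal r → m ≤′ n → Near (2^-[ m ] - 2^-[ n ]) (r m) (r n)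
IsReal⇒Near′ {m = m} r-real (≤′-reflexive refl) = Near-refl (≤-reflexive (sym (+-inverseʳ 2^-[ m ])))
IsReal⇒Near′ {r} {m} r-real (≤′-step {n} m≤′n) =
  Near-weaken (≤-reflexive (eq 2^-[ m ] 2^-[ n ]))
    (Near-trans (IsReal⇒Near′ {r} r-real m≤′n) (∣-∣≤⇒Near (r-real n)))
  where
  eq : ∀ s t → s - t + ½ * t ≡ s - ½ * t
  eq = solve-∀ ℚ-ring

IsReal⇒Near : ∀ {r m n} → IsReal r → m ℕ.≤ n → Near 2^-[ m ] (r m) (r n)
IsReal⇒Near {r} {m} {n} r-real m≤n =
  Near-weaken (≤-bySlack 2^-[ n ] (2^-nonNeg n) (eq 2^-[ m ] 2^-[ n ])) (IsReal⇒Near′ {r} r-real (ℕ.≤⇒≤′ m≤n))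
  where
  eq : ∀ s t → t ≡ s - (s - t)
  eq = solve-∀ ℚ-ring

IsReal⇒Near-any : ∀ {r} → IsReal r → ∀ m n → Near (2^-[ m ] + 2^-[ n ]) (r m) (r n)
IsReal⇒Near-any {r} r-real m n with ℕ.≤-total m n
... | inj₁ m≤n =
  Near-weaken (≤-bySlack 2^-[ n ] (2^-nonNeg n) (eq 2^-[ m ] 2^-[ n ])) (IsReal⇒Near {r} r-real m≤n)
  where
  eq : ∀ s t → t ≡ s + t - s
  eq = solve-∀ ℚ-ring
... | inj₂ n≤m =
  Near-weaken (≤-bySlack 2^-[ m ] (2^-nonNeg m) (eq 2^-[ m ] 2^-[ n ])) (Near-sym (IsReal⇒Near {r} r-real n≤m))
  where
  eq : ∀ s t → s ≡ s + t - t
  eq = solve-∀ ℚ-ring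

Near-+ : ∀ {ε c x} → ∣ x ∣ ≤ ε → Near ε c (c + x)
Near-+ {ε} {c} {x} ∣x∣≤ε =
  ∣-∣≤⇒Near (subst (_≤ ε) (trans (sym (∣-p∣≡∣p∣ x)) (cong ∣_∣ (eq c x))) ∣x∣≤ε)
  where
  eq : ∀ c x → - x ≡ c - (c + x)
  eq = solve-∀ ℚ-ring

∣r*d∣≤r : ∀ {r d} → 0ℚ ≤ r → ∣ d ∣ ≤ 1ℚ → ∣ r * d ∣ ≤ r
∣r*d∣≤r {r} {d} 0≤r ∣d∣≤1 = begin
  ∣ r * d ∣    ≡⟨ ∣p*q∣≡∣p∣*∣q∣ r d ⟩
  ∣ r ∣ * ∣ d ∣ ≡⟨ cong (_* ∣ d ∣) (0≤p⇒∣p∣≡p 0≤r) ⟩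
  r * ∣ d ∣    ≤⟨ *-monoˡ-≤-nonNeg r {{nonNegative 0≤r}} ∣d∣≤1 ⟩
  r * 1ℚ      ≡⟨ *-identityʳ r ⟩
  r           ∎
  where open ≤-Reasoning

infix 4 _∈ᴵ_

record _∈ᴵ_ (q : ℚ) (I : Interval) : Set where
  constructor bounds
  field
    left≤ : left I ≤ q
    ≤right : q ≤ right I
open _∈ᴵ_

⊑-refl : ∀ I → I ⊑ I
⊑-refl (p , q) = ≤-refl , ≤-refl

⊑-trans : ∀ I J K → I ⊑ J → J ⊑ K → I ⊑ K
⊑-trans (p , q) (p′ , q′) (p″ , q″) (p′≤p , q≤q′) (p″≤p′ , q′≤q″) =
  ≤-trans p″≤p′ p′≤p , ≤-trans q≤q′ q′≤q″

∈ᴵ-⊑ : ∀ {q} I J → I ⊑ J → q ∈ᴵ I → q ∈ᴵ J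
∈ᴵ-⊑ (p , q) (p′ , q′) (p′≤p , q≤q′) (bounds p≤x x≤q) =
  bounds (≤-trans p′≤p p≤x) (≤-trans x≤q q≤q′)

len-mono-⊑ : ∀ I J → I ⊑ J → len I ≤ len J
len-mono-⊑ (p , q) (p′ , q′) (p′≤p , q≤q′) =
  ≤-bySlack (q′ - q + (p - p′)) (+-mono-≤ (p≤q⇒0≤q-p q≤q′) (p≤q⇒0≤q-p p′≤p)) (eq p q p′ q′)
  where
  eq : ∀ p q p′ q′ → q′ - q + (p - p′) ≡ q′ - p′ - (q - p)
  eq = solve-∀ ℚ-ring

∈ᴵ⇒Near : ∀ {I p q} → p ∈ᴵ I → q ∈ᴵ I → Near (len I) p q
∈ᴵ⇒Near {I} {p} {q} (bounds l≤p p≤r) (bounds l≤q q≤r) = near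
  (≤-bySlack (right I - p + (q - left I)) (+-mono-≤ (p≤q⇒0≤q-p p≤r) (p≤q⇒0≤q-p l≤q))
    (eq p q (left I) (right I)))
  (≤-bySlack (right I - q + (p - left I)) (+-mono-≤ (p≤q⇒0≤q-p q≤r) (p≤q⇒0≤q-p l≤p))
    (eq q p (left I) (right I)))
  where
  eq : ∀ p q l r → r - p + (q - l) ≡ q + (r - l) - p
  eq = solve-∀ ℚ-ring

widen : ℚ → Interval → Interval
widen ε I = left I - ε , right I + ε

Near-∈ᴵ-widen : ∀ {ε I p q} → Near ε q p → p ∈ᴵ I → q ∈ᴵ widen ε I
Near-∈ᴵ-widen {ε} (near q≤p+ε p≤q+ε) (bounds l≤p p≤r) =
  bounds (p≤q+ε⇒p-ε≤q (≤-trans l≤p p≤q+ε)) (≤-trans q≤p+ε (+-monoˡ-≤ ε p≤r))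

∈ᴵ-widen⇒Near-left : ∀ {ε δ I q} → q ∈ᴵ widen ε I → 0ℚ ≤ δ → len I ≤ δ →
  Near (ε + δ) q (left I)
∈ᴵ-widen⇒Near-left {ε} {δ} {I} {q} (bounds l-ε≤q q≤r+ε) 0≤δ lenI≤δ = near
  (≤-bySlack (right I + ε - q + (δ - len I)) (+-mono-≤ (p≤q⇒0≤q-p q≤r+ε) (p≤q⇒0≤q-p lenI≤δ))
    (eq₁ q ε δ (left I) (right I)))
  (≤-bySlack (q - (left I - ε) + δ) (+-mono-≤ (p≤q⇒0≤q-p l-ε≤q) 0≤δ) (eq₂ q ε δ (left I)))
  where
  eq₁ : ∀ q ε δ l r → r + ε - q + (δ - (r - l)) ≡ l + (ε + δ) - q
  eq₁ = solve-∀ ℚ-ring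
  eq₂ : ∀ q ε δ l → q - (l - ε) + δ ≡ q + (ε + δ) - l
  eq₂ = solve-∀ ℚ-ring

centred : ℚ → ℚ → Interval
centred c e = c - e , c + e

len-centred : ∀ c e → len (centred c e) ≡ e + e
len-centred c e = eq c e
  where
  eq : ∀ c e → c + e - (c - e) ≡ e + e
  eq = solve-∀ ℚ-ring

widen-centred : ∀ ε c e → widen ε (centred c e) ≡ centred c (e + ε)
widen-centred ε c e = cong₂ _,_ (eq₁ ε c e) (eq₂ ε c e)
  where
  eq₁ : ∀ ε c e → c - e - ε ≡ c - (e + ε)
  eq₁ = solve-∀ ℚ-ring
  eq₂ : ∀ ε c e → c + e + ε ≡ c + (e + ε)
  eq₂ = solve-∀ ℚ-ring

Near⇒∈ᴵ-centred : ∀ {e c q} → Near e q c → q ∈ᴵ centred c e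
Near⇒∈ᴵ-centred (near q≤c+e c≤q+e) = bounds (p≤q+ε⇒p-ε≤q c≤q+e) q≤c+e

Near⇒centred-⊑ : ∀ {e e′ c c′} → Near (e - e′) c c′ → centred c′ e′ ⊑ centred c e
Near⇒centred-⊑ {e} {e′} {c} {c′} (near c≤ c′≤) =
  ≤-bySlack (c′ + (e - e′) - c) (p≤q⇒0≤q-p c≤) (eq₁ c c′ e e′) ,
  ≤-bySlack (c + (e - e′) - c′) (p≤q⇒0≤q-p c′≤) (eq₂ c c′ e e′)
  where
  eq₁ : ∀ c c′ e e′ → c′ + (e - e′) - c ≡ c′ - e′ - (c - e)
  eq₁ = solve-∀ ℚ-ring
  eq₂ : ∀ c c′ e e′ → c + (e - e′) - c′ ≡ c + e - (c′ + e′)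
  eq₂ = solve-∀ ℚ-ring

Near⇒left-centred≤right-centred : ∀ {e e′ c c′} → Near (e + e′) c c′ →
  left (centred c e) ≤ right (centred c′ e′)
Near⇒left-centred≤right-centred {e} {e′} {c} {c′} (near c≤ _) =
  ≤-bySlack (c′ + (e + e′) - c) (p≤q⇒0≤q-p c≤) (eq c c′ e e′)
  where
  eq : ∀ c c′ e e′ → c′ + (e + e′) - c ≡ c′ + e′ - (c - e)
  eq = solve-∀ ℚ-ring

≈⇒common-point : ∀ I J → InT I → InT J → I ≈ J → ∃[ p ] (p ∈ᴵ I × p ∈ᴵ J)
≈⇒common-point (a , b) (a′ , b′) a≤b a′≤b′ (a′≤b , a≤b′) =
  a ⊔ a′ , bounds (p≤p⊔q a a′) (⊔-lub a≤b a′≤b) , bounds (p≤q⊔p a a′) (⊔-lub a≤b′ a′≤b′)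

meet : Interval → List Interval → Interval
meet I []       = I
meet I (J ∷ Js) = left I ⊔ left (meet J Js) , right I ⊓ right (meet J Js)

⋂ : List Interval → Maybe Interval
⋂ []       = nothing
⋂ (I ∷ Is) = just (meet I Is)

meet-⊑ : ∀ {J} I Is → J ∈ I ∷ Is → meet I Is ⊑ J
meet-⊑ I []       (here refl) = ⊑-refl I
meet-⊑ I (J ∷ Js) (here refl) = p≤p⊔q (left I) (left (meet J Js)) , p⊓q≤p (right I) (right (meet J Js))
meet-⊑ I (J ∷ Js) (there K∈) with meet-⊑ J Js K∈
... | l≤ , ≤r =
  ≤-trans l≤ (p≤q⊔p (left I) (left (meet J Js))) , ≤-trans (p⊓q≤q (right I) (right (meet J Js))) ≤r

left-meet≤ : ∀ {a} I Is → (∀ {J} → J ∈ I ∷ Is → left J ≤ a) → left (meet I Is) ≤ a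
left-meet≤ I []       bound = bound (here refl)
left-meet≤ I (J ∷ Js) bound = ⊔-lub (bound (here refl)) (left-meet≤ J Js (λ J∈ → bound (there J∈)))

≤right-meet : ∀ {a} I Is → (∀ {J} → J ∈ I ∷ Is → a ≤ right J) → a ≤ right (meet I Is)
≤right-meet I []       bound = bound (here refl)
≤right-meet I (J ∷ Js) bound = ⊓-glb (bound (here refl)) (≤right-meet J Js (λ J∈ → bound (there J∈)))

⋂-⊑ : ∀ {L I J} → ⋂ L ≡ just I → J ∈ L → I ⊑ J
⋂-⊑ {I ∷ Is} refl J∈ = meet-⊑ I Is J∈

left-⋂≤ : ∀ {L I a} → ⋂ L ≡ just I → (∀ {J} → J ∈ L → left J ≤ a) → left I ≤ a
left-⋂≤ {I ∷ Is} refl = left-meet≤ I Is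

≤right-⋂ : ∀ {L I a} → ⋂ L ≡ just I → (∀ {J} → J ∈ L → a ≤ right J) → a ≤ right I
≤right-⋂ {I ∷ Is} refl = ≤right-meet I Is

∈⇒⋂-just : ∀ {L J} → J ∈ L → ∃[ I ] ⋂ L ≡ just I
∈⇒⋂-just {I ∷ Is} _ = meet I Is , refl

⋂-just⇒nonempty : ∀ {L I} → ⋂ L ≡ just I → ∃[ J ] J ∈ L
⋂-just⇒nonempty {J ∷ _} refl = J , here refl

left-⋂≤right-⋂ : ∀ {L L′ I I′} → ⋂ L ≡ just I → ⋂ L′ ≡ just I′ →
  (∀ {J J′} → J ∈ L → J′ ∈ L′ → left J ≤ right J′) → left I ≤ right I′
left-⋂≤right-⋂ eq eq′ overlaps = left-⋂≤ eq (λ J∈ → ≤right-⋂ eq′ (overlaps J∈))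

⋂-++-⊑ : ∀ {L L′ I I′} → ⋂ L ≡ just I → ⋂ (L′ ++ L) ≡ just I′ → I′ ⊑ I
⋂-++-⊑ {L′ = L′} eq eq′ =
  left-⋂≤ eq (λ J∈ → proj₁ (⋂-⊑ eq′ (∈-++⁺ʳ L′ J∈))) ,
  ≤right-⋂ eq (λ J∈ → proj₂ (⋂-⊑ eq′ (∈-++⁺ʳ L′ J∈)))

∈ᴵ-widen-⋂ : ∀ {L I ε q} → ⋂ L ≡ just I → (∀ {J} → J ∈ L → q ∈ᴵ widen ε J) → q ∈ᴵ widen ε I
∈ᴵ-widen-⋂ eq q∈ = bounds
  (p≤q+ε⇒p-ε≤q (left-⋂≤ eq (λ J∈ → p-ε≤q⇒p≤q+ε (left≤ (q∈ J∈)))))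
  (p-ε≤q⇒p≤q+ε (≤right-⋂ eq (λ J∈ → p≤q+ε⇒p-ε≤q (≤right (q∈ J∈)))))

radius : List Three → ℚ
radius s = 2^-[ suc (length s) ]

centre : List Three → ℚ
centre s = radius s * (N s / 1)

digit : Three → ℚ
digit i = (+ toℕ i ℤ.- + 1) / 1

∣digit∣≤1 : ∀ i → ∣ digit i ∣ ≤ 1ℚ
∣digit∣≤1 0F              = ≤ᵇ⇒≤ tt
∣digit∣≤1 (sucF 0F)       = ≤ᵇ⇒≤ tt
∣digit∣≤1 (sucF (sucF 0F)) = ≤ᵇ⇒≤ tt

𝕀≡centred : ∀ s → 𝕀 s ≡ centred (centre s) (radius s)
𝕀≡centred s = cong₂ _,_
  (trans (cong (radius s *_) (/1-homo-+ (N s) (ℤ.- + 1))) (eq₁ (radius s) (N s / 1)))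
  (trans (cong (radius s *_) (/1-homo-+ (N s) (+ 1))) (eq₂ (radius s) (N s / 1)))
  where
  eq₁ : ∀ r n → r * (n + - 1ℚ) ≡ r * n - r
  eq₁ = solve-∀ ℚ-ring
  eq₂ : ∀ r n → r * (n + 1ℚ) ≡ r * n + r
  eq₂ = solve-∀ ℚ-ring

length-∷ʳ : ∀ (s : List Three) i → length (s ∷ʳ i) ≡ suc (length s)
length-∷ʳ s i = trans (List.length-++ s) (ℕ.+-comm (length s) 1)

radius-∷ʳ : ∀ s i → radius (s ∷ʳ i) ≡ ½ * radius s
radius-∷ʳ s i = cong (λ n → 2^-[ suc n ]) (length-∷ʳ s i)

N/1-∷ʳ : ∀ s i → N (s ∷ʳ i) / 1 ≡ N s / 1 + N s / 1 + digit i
N/1-∷ʳ s i = begin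
  N (s ∷ʳ i) / 1                          ≡⟨ cong (_/ 1) (List.foldl-∷ʳ _ (+ 1) i s) ⟩
  (+ 2 ℤ.* N s ℤ.+ (+ toℕ i ℤ.- + 1)) / 1  ≡⟨ /1-homo-+ (+ 2 ℤ.* N s) (+ toℕ i ℤ.- + 1) ⟩
  (+ 2 ℤ.* N s) / 1 + digit i             ≡⟨ cong (λ n → n / 1 + digit i) (2*n≡n+n (N s)) ⟩
  (N s ℤ.+ N s) / 1 + digit i             ≡⟨ cong (_+ digit i) (/1-homo-+ (N s) (N s)) ⟩
  N s / 1 + N s / 1 + digit i             ∎
  where
  open ≡-Reasoning
  2*n≡n+n : ∀ n → + 2 ℤ.* n ≡ n ℤ.+ n
  2*n≡n+n n = trans (ℤ.*-distribʳ-+ n (+ 1) (+ 1)) (cong₂ ℤ._+_ (ℤ.*-identityˡ n) (ℤ.*-identityˡ n))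

centre-∷ʳ : ∀ s i → centre (s ∷ʳ i) ≡ centre s + radius (s ∷ʳ i) * digit i
centre-∷ʳ s i =
  trans (cong (radius (s ∷ʳ i) *_) (N/1-∷ʳ s i)) (halve (radius s) (N s / 1) (digit i) (radius-∷ʳ s i))
  where
  halve : ∀ {r′} r n d → r′ ≡ ½ * r → r′ * (n + n + d) ≡ r * n + r′ * d
  halve r n d refl = eq r n d
    where
    eq : ∀ r n d → ½ * r * (n + n + d) ≡ r * n + ½ * r * d
    eq = solve-∀ ℚ-ring

centre-near-child : ∀ s i → Near (radius (s ∷ʳ i)) (centre s) (centre (s ∷ʳ i))
centre-near-child s i = subst (Near (radius (s ∷ʳ i)) (centre s)) (sym (centre-∷ʳ s i))
  (Near-+ (∣r*d∣≤r (2^-nonNeg (suc (length (s ∷ʳ i)))) (∣digit∣≤1 i)))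

radius-minus-radius-∷ʳ : ∀ s i → radius s - radius (s ∷ʳ i) ≡ radius (s ∷ʳ i)
radius-minus-radius-∷ʳ s i =
  trans (cong (λ r′ → radius s - r′) (radius-∷ʳ s i)) (trans (eq (radius s)) (sym (radius-∷ʳ s i)))
  where
  eq : ∀ r → r - ½ * r ≡ ½ * r
  eq = solve-∀ ℚ-ring

𝕀-∷ʳ-⊑ : ∀ s i → 𝕀 (s ∷ʳ i) ⊑ 𝕀 s
𝕀-∷ʳ-⊑ s i = subst₂ _⊑_ (sym (𝕀≡centred (s ∷ʳ i))) (sym (𝕀≡centred s))
  (Near⇒centred-⊑ (subst (λ e → Near e (centre s) (centre (s ∷ʳ i)))
    (sym (radius-minus-radius-∷ʳ s i)) (centre-near-child s i)))

centre∈𝕀-∷ʳ : ∀ s i → centre s ∈ᴵ 𝕀 (s ∷ʳ i)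
centre∈𝕀-∷ʳ s i =
  subst (centre s ∈ᴵ_) (sym (𝕀≡centred (s ∷ʳ i))) (Near⇒∈ᴵ-centred (centre-near-child s i))

centre∈𝕀 : ∀ s → centre s ∈ᴵ 𝕀 s
centre∈𝕀 s =
  subst (centre s ∈ᴵ_) (sym (𝕀≡centred s)) (Near⇒∈ᴵ-centred (Near-refl (2^-nonNeg (suc (length s)))))

len-𝕀 : ∀ s → len (𝕀 s) ≡ 2^-[ length s ]
len-𝕀 s = trans (cong len (𝕀≡centred s)) (trans (len-centred (centre s) (radius s)) (2^-suc+2^-suc (length s)))

𝕀⊑unit : ∀ s → 𝕀 s ⊑ (0ℚ , 1ℚ)
𝕀⊑unit s = go (reverseView s)
  where
  go : ∀ {s} → Reverse s → 𝕀 s ⊑ (0ℚ , 1ℚ)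
  go []           = ⊑-refl (0ℚ , 1ℚ)
  go (s ∶ r ∶ʳ i) = ⊑-trans (𝕀 (s ∷ʳ i)) (𝕀 s) (0ℚ , 1ℚ) (𝕀-∷ʳ-⊑ s i) (go r)

length-prefix : ∀ α n → length (prefix α n) ≡ n
length-prefix α zero    = refl
length-prefix α (suc n) = trans (length-∷ʳ (prefix α n) (α n)) (cong suc (length-prefix α n))

Φ≡centre : ∀ α n → Φ α n ≡ centre (prefix α n)
Φ≡centre α n = cong (λ m → 2^-[ suc m ] * (N (prefix α n) / 1)) (sym (length-prefix α n))

Φ∈𝕀 : ∀ α n → Φ α n ∈ᴵ 𝕀 (prefix α n)
Φ∈𝕀 α n = subst (_∈ᴵ 𝕀 (prefix α n)) (sym (Φ≡centre α n)) (centre∈𝕀 (prefix α n))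

prefix-⊑′ : ∀ α {m n} → m ≤′ n → 𝕀 (prefix α n) ⊑ 𝕀 (prefix α m)
prefix-⊑′ α {m} (≤′-reflexive refl) = ⊑-refl (𝕀 (prefix α m))
prefix-⊑′ α {m} (≤′-step {n} m≤′n)  =
  ⊑-trans (𝕀 (prefix α (suc n))) (𝕀 (prefix α n)) (𝕀 (prefix α m))
    (𝕀-∷ʳ-⊑ (prefix α n) (α n)) (prefix-⊑′ α m≤′n)

prefix-⊑ : ∀ α {m n} → m ℕ.≤ n → 𝕀 (prefix α n) ⊑ 𝕀 (prefix α m)
prefix-⊑ α m≤n = prefix-⊑′ α (ℕ.≤⇒≤′ m≤n)

Φ-IsReal : ∀ α → IsReal (Φ α)
Φ-IsReal α n =
  Near⇒∣-∣≤ (subst (λ ε → Near ε (Φ α n) (Φ α (suc n))) len≡ (∈ᴵ⇒Near Φn∈ (Φ∈𝕀 α (suc n))))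
  where
  Φn∈ : Φ α n ∈ᴵ 𝕀 (prefix α (suc n))
  Φn∈ = subst (_∈ᴵ 𝕀 (prefix α (suc n))) (sym (Φ≡centre α n)) (centre∈𝕀-∷ʳ (prefix α n) (α n))
  len≡ : len (𝕀 (prefix α (suc n))) ≡ 2^-[ suc n ]
  len≡ = trans (len-𝕀 (prefix α (suc n))) (cong 2^-[_] (length-prefix α (suc n)))

infix 4 _∈ʳ_

_∈ʳ_ : Seq → Interval → Set
x ∈ʳ I = ∀ n → x n ∈ᴵ widen 2^-[ n ] I

widen-⊑ : ∀ ε I J → I ⊑ J → widen ε I ⊑ widen ε J
widen-⊑ ε (p , q) (p′ , q′) (p′≤p , q≤q′) = +-monoˡ-≤ (- ε) p′≤p , +-monoˡ-≤ ε q≤q′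

∈ʳ-⊑ : ∀ {x} I J → I ⊑ J → x ∈ʳ I → x ∈ʳ J
∈ʳ-⊑ I J I⊑J x∈I n = ∈ᴵ-⊑ (widen 2^-[ n ] I) (widen 2^-[ n ] J) (widen-⊑ 2^-[ n ] I J I⊑J) (x∈I n)

const-∈ʳ : ∀ {p I} → p ∈ᴵ I → const p ∈ʳ I
const-∈ʳ p∈I n = Near-∈ᴵ-widen (Near-refl (2^-nonNeg n)) p∈I

∈ʳ𝕀⇒In01 : ∀ {x} s → x ∈ʳ 𝕀 s → In01 x
∈ʳ𝕀⇒In01 s x∈ n with ∈ʳ-⊑ (𝕀 s) (0ℚ , 1ℚ) (𝕀⊑unit s) x∈ n
... | bounds 0-ε≤x x≤1+ε = 0-ε≤x , x≤1+ε

∈ʳ⇒DistLe : ∀ {x p I} → x ∈ʳ I → p ∈ᴵ I → DistLe (const p) x (len I)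
∈ʳ⇒DistLe {x} {p} {I} x∈I p∈I n = Near⇒∣-∣≤
  (subst (λ ε → Near ε p (x (suc n))) (eq (left I) (right I) 2^-[ n ])
    (∈ᴵ⇒Near (Near-∈ᴵ-widen (Near-refl (2^-nonNeg (suc n))) p∈I) (x∈I (suc n))))
  where
  eq : ∀ l r t → r + ½ * t - (l - ½ * t) ≡ r - l + t
  eq = solve-∀ ℚ-ring

const-Real01 : ∀ {p} s → p ∈ᴵ 𝕀 s → Real01 (const p)
const-Real01 {p} s p∈ =
  (λ n → Near⇒∣-∣≤ {p = p} (Near-refl (2^-nonNeg (suc n)))) , ∈ʳ𝕀⇒In01 s (const-∈ʳ p∈)

Φ∈ʳ𝕀 : ∀ α m → Φ α ∈ʳ 𝕀 (prefix α m)
Φ∈ʳ𝕀 α m n with ℕ.≤-total m n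
... | inj₁ m≤n = const-∈ʳ (∈ᴵ-⊑ (𝕀 (prefix α n)) (𝕀 (prefix α m)) (prefix-⊑ α m≤n) (Φ∈𝕀 α n)) n
... | inj₂ n≤m =
  Near-∈ᴵ-widen (subst (λ ε → Near ε (Φ α n) (Φ α m)) len≡ (∈ᴵ⇒Near (Φ∈𝕀 α n) Φm∈)) (Φ∈𝕀 α m)
  where
  Φm∈ : Φ α m ∈ᴵ 𝕀 (prefix α n)
  Φm∈ = ∈ᴵ-⊑ (𝕀 (prefix α m)) (𝕀 (prefix α n)) (prefix-⊑ α n≤m) (Φ∈𝕀 α m)
  len≡ : len (𝕀 (prefix α n)) ≡ 2^-[ n ]
  len≡ = trans (len-𝕀 (prefix α n)) (cong 2^-[_] (length-prefix α n))

Φ-Real01 : ∀ α → Real01 (Φ α)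
Φ-Real01 α = Φ-IsReal α , ∈ʳ𝕀⇒In01 [] (Φ∈ʳ𝕀 α 0)

≃-realOfCode : ∀ (ψ : PreCode) (c : IsCode ψ) α {y} → IsReal y →
  (∀ H {I} → ψ (prefix α H) ≡ just I → ∀ K → y (suc K) ∈ᴵ widen (2^-[ K ] + 2^-[ K ]) I) →
  y ≃ realOfCode ψ c α
≃-realOfCode ψ c α {y} y-real approx n =
  Near⇒∣-∣≤ {2^-[ n ]} {y (suc n)} {left J} (Near-weaken (≤-reflexive (eq 2^-[ n ])) close)
  where
  -- realOfCode at n+1 is the left end of J = 𝕁 (δ (n+1)), an interval of length at most 2^-(n+2)
  -- which contains y (n+4) up to 2^-(n+2); regularity of y bridges from n+1 to n+4.
  m : ℕ
  m = δ ψ c α (suc n)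
  J : Interval
  J = 𝕁 ψ c α m
  y∈J : y (suc (suc (suc (suc n)))) ∈ᴵ widen (2^-[ suc (suc (suc n)) ] + 2^-[ suc (suc (suc n)) ]) J
  y∈J = approx (h ψ c α m) (proj₁ (proj₂ (proj₂ (hdata ψ c α m)))) (suc (suc (suc n)))
  short : len J ≤ 2^-[ suc (suc n) ]
  short = proj₂ (least (λ k → len (𝕁 ψ c α k) ≤? 2^-[ suc (suc n) ]) (suc (suc n)) (𝕁-len ψ c α (suc (suc n))))
  regular : Near 2^-[ suc n ] (y (suc n)) (y (suc (suc (suc (suc n)))))
  regular = IsReal⇒Near {y} y-real (ℕ.m≤n+m (suc n) 3)
  close : Near (2^-[ suc n ] + ((2^-[ suc (suc (suc n)) ] + 2^-[ suc (suc (suc n)) ]) + 2^-[ suc (suc n) ]))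
               (y (suc n)) (left J)
  close = Near-trans regular
    (∈ᴵ-widen⇒Near-left {2^-[ suc (suc (suc n)) ] + 2^-[ suc (suc (suc n)) ]} {2^-[ suc (suc n) ]} {J}
      y∈J (2^-nonNeg (suc (suc n))) short)
  eq : ∀ t → ½ * t + ((½ * (½ * (½ * t)) + ½ * (½ * (½ * t))) + ½ * (½ * t)) ≡ t
  eq = solve-∀ ℚ-ring

module Construction (f : Seq → Seq) (f-fun : IsFun01 f) (ω : ℕ → ℕ)
  (ω-modulus : ∀ k x y → Real01 x → Real01 y → DistLe x y 2^-[ ω k ] → DistLe (f x) (f y) 2^-[ k ]) where

  sample : List Three → Seq
  sample u = f (const (centre u))

  sample-IsReal : ∀ u → IsReal (sample u)
  sample-IsReal u = proj₁ f-fun (const (centre u)) (const-Real01 u (centre∈𝕀 u))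

  sample-near : ∀ {j} x u → Real01 x → x ∈ʳ 𝕀 u → ω j ℕ.≤ length u → ∀ K →
    Near (2^-[ j ] + 2^-[ suc K ] + (2^-[ j ] + 2^-[ K ])) (sample u j) (f x (suc K))
  sample-near {j} x u x-real x∈u ωj≤ K =
    Near-trans (IsReal⇒Near-any {sample u} (sample-IsReal u) j (suc K))
      (∣-∣≤⇒Near (ω-modulus j (const (centre u)) x (const-Real01 u (centre∈𝕀 u)) x-real centre-close K))
    where
    centre-close : DistLe (const (centre u)) x 2^-[ ω j ]
    centre-close n = ≤-trans (∈ʳ⇒DistLe x∈u (centre∈𝕀 u) n)
      (+-monoˡ-≤ 2^-[ n ] (≤-trans (≤-reflexive (len-𝕀 u)) (2^-antitone ωj≤)))

  ball : ℕ → List Three → Interval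
  ball j u = centred (sample u (suc (suc j))) 2^-[ j ]

  ball-overlap : ∀ {j j′} x u w → Real01 x → x ∈ʳ 𝕀 u → x ∈ʳ 𝕀 w →
    ω (suc (suc j)) ℕ.≤ length u → ω (suc (suc j′)) ℕ.≤ length w → left (ball j u) ≤ right (ball j′ w)
  ball-overlap {j} {j′} x u w x-real x∈u x∈w ω≤u ω≤w = Near⇒left-centred≤right-centred
    (Near-weaken slack
      (Near-trans (sample-near x u x-real x∈u ω≤u K) (Near-sym (sample-near x w x-real x∈w ω≤w K))))
    where
    K : ℕ
    K = suc (suc j) ℕ.+ suc (suc j′)
    c≤a : 2^-[ K ] ≤ 2^-[ suc (suc j) ]
    c≤a = 2^-antitone (ℕ.m≤m+n (suc (suc j)) (suc (suc j′)))
    c≤b : 2^-[ K ] ≤ 2^-[ suc (suc j′) ]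
    c≤b = 2^-antitone (ℕ.m≤n+m (suc (suc j′)) (suc (suc j)))
    d₁ d₂ : ℚ
    d₁ = 2^-[ suc (suc j) ] - 2^-[ K ]
    d₂ = 2^-[ suc (suc j′) ] - 2^-[ K ]
    0≤d₁ : 0ℚ ≤ d₁
    0≤d₁ = p≤q⇒0≤q-p c≤a
    0≤d₂ : 0ℚ ≤ d₂
    0≤d₂ = p≤q⇒0≤q-p c≤b
    slack : 2^-[ suc (suc j) ] + 2^-[ suc K ] + (2^-[ suc (suc j) ] + 2^-[ K ])
              + (2^-[ suc (suc j′) ] + 2^-[ suc K ] + (2^-[ suc (suc j′) ] + 2^-[ K ]))
            ≤ 2^-[ j ] + 2^-[ j′ ]
    slack = ≤-bySlack (d₁ + d₁ + (d₂ + d₂) + 2^-[ K ])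
      (+-mono-≤ (+-mono-≤ (+-mono-≤ 0≤d₁ 0≤d₁) (+-mono-≤ 0≤d₂ 0≤d₂)) (2^-nonNeg K))
      (eq 2^-[ j ] 2^-[ j′ ] 2^-[ K ])
      where
      eq : ∀ t t′ c → let a = ½ * (½ * t); b = ½ * (½ * t′) in
        a - c + (a - c) + (b - c + (b - c)) + c ≡ t + t′ - (a + ½ * c + (a + c) + (b + ½ * c + (b + c)))
      eq = solve-∀ ℚ-ring

  ball-approx : ∀ {j} x u → Real01 x → x ∈ʳ 𝕀 u → ω (suc (suc j)) ℕ.≤ length u → ∀ K →
    f x (suc K) ∈ᴵ widen (2^-[ K ] + 2^-[ K ]) (ball j u)
  ball-approx {j} x u x-real x∈u ω≤ K =
    subst (f x (suc K) ∈ᴵ_) (sym (widen-centred (2^-[ K ] + 2^-[ K ]) (sample u (suc (suc j))) 2^-[ j ]))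
      (Near⇒∈ᴵ-centred (Near-sym (Near-weaken slack (sample-near x u x-real x∈u ω≤ K))))
    where
    slack : 2^-[ suc (suc j) ] + 2^-[ suc K ] + (2^-[ suc (suc j) ] + 2^-[ K ]) ≤ 2^-[ j ] + (2^-[ K ] + 2^-[ K ])
    slack = ≤-bySlack (2^-[ suc (suc j) ] + 2^-[ suc (suc j) ] + 2^-[ suc K ])
      (+-mono-≤ (+-mono-≤ (2^-nonNeg (suc (suc j))) (2^-nonNeg (suc (suc j)))) (2^-nonNeg (suc K)))
      (eq 2^-[ j ] 2^-[ K ])
      where
      eq : ∀ t c → let a = ½ * (½ * t) in a + a + ½ * c ≡ t + (c + c) - (a + ½ * c + (a + c))
      eq = solve-∀ ℚ-ring

  ownBalls : List Three → List Interval
  ownBalls u = map (λ j → ball j u) (filter (λ j → ω (suc (suc j)) ℕ.≤? length u) (upTo (suc (length u))))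

  -- Indexed by the reversed node, so that extending a node conses onto the index.
  ancestralBalls : List Three → List Interval
  ancestralBalls []      = ownBalls []
  ancestralBalls (i ∷ r) = ownBalls (reverse (i ∷ r)) ++ ancestralBalls r

  φ : PreCode
  φ s = ⋂ (ancestralBalls (reverse s))

  BallAbove : List Three → Interval → Set
  BallAbove s J = ∃₂ λ u j → J ≡ ball j u × ω (suc (suc j)) ℕ.≤ length u × 𝕀 s ⊑ 𝕀 u

  ownBalls⇒BallAbove : ∀ u {J} → J ∈ ownBalls u → BallAbove u J
  ownBalls⇒BallAbove u J∈ with ∈-map⁻ (λ j → ball j u) J∈
  ... | j , j∈ , refl =
    u , j , refl , proj₂ (∈-filter⁻ (λ j → ω (suc (suc j)) ℕ.≤? length u) j∈) , ⊑-refl (𝕀 u)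

  ancestral⇒BallAbove′ : ∀ r {J} → J ∈ ancestralBalls r → BallAbove (reverse r) J
  ancestral⇒BallAbove′ []      J∈ = ownBalls⇒BallAbove [] J∈
  ancestral⇒BallAbove′ (i ∷ r) J∈ with ∈-++⁻ (ownBalls (reverse (i ∷ r))) J∈
  ... | inj₁ J∈own = ownBalls⇒BallAbove (reverse (i ∷ r)) J∈own
  ... | inj₂ J∈anc with ancestral⇒BallAbove′ r J∈anc
  ...   | u , j , J≡ , ω≤ , r⊑u =
    u , j , J≡ , ω≤ , ⊑-trans (𝕀 (reverse (i ∷ r))) (𝕀 (reverse r)) (𝕀 u) child⊑ r⊑u
    where
    child⊑ : 𝕀 (reverse (i ∷ r)) ⊑ 𝕀 (reverse r)
    child⊑ = subst (λ v → 𝕀 v ⊑ 𝕀 (reverse r)) (sym (List.unfold-reverse i r)) (𝕀-∷ʳ-⊑ (reverse r) i)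

  ancestral⇒BallAbove : ∀ s {J} → J ∈ ancestralBalls (reverse s) → BallAbove s J
  ancestral⇒BallAbove s {J} J∈ =
    subst (λ v → BallAbove v J) (List.reverse-involutive s) (ancestral⇒BallAbove′ (reverse s) J∈)

  ownBalls⊆ancestralBalls : ∀ s {J} → J ∈ ownBalls s → J ∈ ancestralBalls (reverse s)
  ownBalls⊆ancestralBalls s {J} J∈ =
    go (reverse s) (subst (λ v → J ∈ ownBalls v) (sym (List.reverse-involutive s)) J∈)
    where
    go : ∀ r {J} → J ∈ ownBalls (reverse r) → J ∈ ancestralBalls r
    go []      J∈ = J∈
    go (i ∷ r) J∈ = ∈-++⁺ˡ J∈

  ball∈ownBalls : ∀ u {j} → j ℕ.≤ length u → ω (suc (suc j)) ℕ.≤ length u → ball j u ∈ ownBalls u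
  ball∈ownBalls u j≤ ω≤ =
    ∈-map⁺ (λ j → ball j u) (∈-filter⁺ (λ j → ω (suc (suc j)) ℕ.≤? length u) (∈-upTo⁺ (ℕ.s≤s j≤)) ω≤)

  𝕀-InT : ∀ s → InT (𝕀 s)
  𝕀-InT s = ≤-trans (left≤ (centre∈𝕀 s)) (≤right (centre∈𝕀 s))

  BallAbove-overlap : ∀ s t {J J′} → BallAbove s J → BallAbove t J′ → 𝕀 s ≈ 𝕀 t → left J ≤ right J′
  BallAbove-overlap s t (u , j , refl , ω≤u , s⊑u) (w , j′ , refl , ω≤w , t⊑w) s≈t =
    ball-overlap (const p) u w (const-Real01 s p∈s) (const-∈ʳ p∈u) (const-∈ʳ p∈w) ω≤u ω≤w
    where
    common : ∃[ p ] (p ∈ᴵ 𝕀 s × p ∈ᴵ 𝕀 t)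
    common = ≈⇒common-point (𝕀 s) (𝕀 t) (𝕀-InT s) (𝕀-InT t) s≈t
    p : ℚ
    p = proj₁ common
    p∈s : p ∈ᴵ 𝕀 s
    p∈s = proj₁ (proj₂ common)
    p∈u : p ∈ᴵ 𝕀 u
    p∈u = ∈ᴵ-⊑ (𝕀 s) (𝕀 u) s⊑u p∈s
    p∈w : p ∈ᴵ 𝕀 w
    p∈w = ∈ᴵ-⊑ (𝕀 t) (𝕀 w) t⊑w (proj₂ (proj₂ common))

  φ-overlap : ∀ s t {I J} → φ s ≡ just I → φ t ≡ just J → 𝕀 s ≈ 𝕀 t → left I ≤ right J
  φ-overlap s t φs≡I φt≡J s≈t = left-⋂≤right-⋂ φs≡I φt≡J
    (λ J∈ J′∈ → BallAbove-overlap s t (ancestral⇒BallAbove s J∈) (ancestral⇒BallAbove t J′∈) s≈t)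

  φ-refines : ∀ s i I → φ s ≡ just I → Σ[ J ∈ Interval ] (φ (s ∷ʳ i) ≡ just J × J ⊑ I)
  φ-refines s i I φs≡I with ⋂-just⇒nonempty φs≡I
  ... | K , K∈ with ∈⇒⋂-just (∈-++⁺ʳ (ownBalls (reverse (i ∷ reverse s))) K∈)
  ...   | J , ⋂≡J =
    J , trans (cong (λ v → ⋂ (ancestralBalls v)) (List.reverse-++ s [ i ])) ⋂≡J , ⋂-++-⊑ φs≡I ⋂≡J

  φ-below-ownBall : ∀ s {J} → J ∈ ownBalls s → Σ[ I ∈ Interval ] (φ s ≡ just I × I ⊑ J)
  φ-below-ownBall s J∈ with ∈⇒⋂-just (ownBalls⊆ancestralBalls s J∈)
  ... | I , φs≡I = I , φs≡I , ⋂-⊑ φs≡I (ownBalls⊆ancestralBalls s J∈)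

  φ-fine : ∀ k α → Fine φ (prefix α (suc k ℕ.+ ω (suc (suc (suc k))))) k
  φ-fine k α = I , φs≡I , ≤-trans (len-mono-⊑ I (ball (suc k) s) I⊑ball) (≤-reflexive len-ball)
    where
    n : ℕ
    n = suc k ℕ.+ ω (suc (suc (suc k)))
    s : List Three
    s = prefix α n
    j≤ : suc k ℕ.≤ length s
    j≤ = subst (suc k ℕ.≤_) (sym (length-prefix α n)) (ℕ.m≤m+n (suc k) (ω (suc (suc (suc k)))))
    ω≤ : ω (suc (suc (suc k))) ℕ.≤ length s
    ω≤ = subst (ω (suc (suc (suc k))) ℕ.≤_) (sym (length-prefix α n)) (ℕ.m≤n+m (ω (suc (suc (suc k)))) (suc k))
    below : Σ[ I ∈ Interval ] (φ s ≡ just I × I ⊑ ball (suc k) s)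
    below = φ-below-ownBall s (ball∈ownBalls s j≤ ω≤)
    I : Interval
    I = proj₁ below
    φs≡I : φ s ≡ just I
    φs≡I = proj₁ (proj₂ below)
    I⊑ball : I ⊑ ball (suc k) s
    I⊑ball = proj₂ (proj₂ below)
    len-ball : len (ball (suc k) s) ≡ 2^-[ k ]
    len-ball = trans (len-centred (sample s (suc (suc (suc k)))) 2^-[ suc k ]) (2^-suc+2^-suc k)

  isCode : IsCode φ
  isCode = record
    { C1 = λ { s (_ , _) φs≡I → φ-overlap s s φs≡I φs≡I (𝕀-InT s , 𝕀-InT s) }
    ; C2 = λ k α → suc k ℕ.+ ω (suc (suc (suc k))) , φ-fine k α
    ; C3 = φ-refines
    ; C4 = λ { s t (_ , _) (_ , _) φs≡I φt≡J s≈t →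
               φ-overlap t s φt≡J φs≡I (swap s≈t) , φ-overlap s t φs≡I φt≡J s≈t }
    }

  uniform : UniformlyContinuousCode φ
  uniform k = suc k ℕ.+ ω (suc (suc (suc k))) , φ-fine k

  φ-approx : ∀ α H {I} → φ (prefix α H) ≡ just I → ∀ K → f (Φ α) (suc K) ∈ᴵ widen (2^-[ K ] + 2^-[ K ]) I
  φ-approx α H φ≡I K = ∈ᴵ-widen-⋂ φ≡I (λ J∈ → approx (ancestral⇒BallAbove (prefix α H) J∈))
    where
    approx : ∀ {J} → BallAbove (prefix α H) J → f (Φ α) (suc K) ∈ᴵ widen (2^-[ K ] + 2^-[ K ]) J
    approx (u , j , refl , ω≤ , ⊑u) =
      ball-approx (Φ α) u (Φ-Real01 α) (∈ʳ-⊑ (𝕀 (prefix α H)) (𝕀 u) ⊑u (Φ∈ʳ𝕀 α H)) ω≤ K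

  induced : InducedBy f φ isCode
  induced α = ≃-realOfCode φ isCode α {f (Φ α)} (proj₁ f-fun (Φ α) (Φ-Real01 α)) (φ-approx α)

lemma6p12 : (f : Seq → Seq) → IsFun01 f → UniformlyContinuous f →
    Σ[ φ ∈ PreCode ] Σ[ c ∈ IsCode φ ] (UniformlyContinuousCode φ × InducedBy f φ c)
lemma6p12 f f-fun (ω , ω-modulus) = φ , isCode , uniform , induced
  where open Construction f f-fun ω ω-modulus
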